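{- Let $k\ge3$ and let $\mathcal H$ be any $2$-colorable $k$-uniform hypergraph on $\{1,\dots,n\}$. Then for every sequence of queries $u_1,u_2,\dots$ to the algorithm Coloring-Oracle on $\mathcal H$, the returned colors are consistent with a single proper $2$-coloring of $\mathcal H$.
   Context: A $k$-uniform hypergraph has edges that are $k$-element vertex sets; a proper (legal) $2$-coloring is a map $c$ to $\{0,1\}$ with no monochromatic edge. For a vertex $v$ and set $X$, $N(v,X)$ is the set of $(k-1)$-subsets of $X$ forming an edge with $v$. $K_{\ell,\ell}$ is the $k$-graph on disjoint $\ell$-sets $A,B$ whose edges are all $k$-sets with one vertex in one of $A,B$ and $k-1$ in the other; $2\ell$ vertices $x_1,\dots,x_{2\ell}$ span a copy of $K_{\ell,\ell}$ if they can be split into $\ell$-sets $A,B$ such that all these $k$-sets are edges of $\mathcal H$ ($A,B$: the independent sets of the copy). Let $\ell=5k$. Colorings are compared lexicographically as strings $(c(1),\dots,c(n))$. The randomized algorithm Coloring-Oracle, given a vertex $u$ and edge-query access to $\mathcal H$ (and keeping no memory between calls): (a) repeatedly samples uniformly random tuples $(x_1,\dots,x_{2\ell},y_1,\dots,y_{k-1})$ of vertices until (i) $x_1,\dots,x_{2\ell}$ span a copy of $K_{\ell,\ell}$ with independent sets $A,B$, and (ii) either (ii.1) $\{1,y_1,\dots,y_{k-1}\}\in E(\mathcal H)$ and $N(y_i,A)\ne\emptyset$ for all $i$, in which case it sets $c_A=0,c_B=1$, or (ii.2) $\{1,y_1,\dots,y_{k-1}\}\in E(\mathcal H)$ and $N(y_i,B)\ne\emptyset$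 for all $i$, in which case it sets $c_A=1,c_B=0$; if all such tuples have been inspected without success it goes to step (c). (b) It repeatedly samples uniformly random $(k-1)$-tuples $v_1,\dots,v_{k-1}$: if $\{u,v_1,\dots,v_{k-1}\}\in E(\mathcal H)$ and $N(v_i,A)\ne\emptyset$ for all $i$ it returns $c_A$; if $\{u,v_1,\dots,v_{k-1}\}\in E(\mathcal H)$ and $N(v_i,B)\ne\emptyset$ for all $i$ it returns $c_B$; if all $(k-1)$-tuples have been inspected without success it goes to step (c). (c) It exhaustively finds the lexicographically first proper $2$-coloring $c$ of $\mathcal H$ and returns $c(u)$. -}

module Defs where

open import Data.Nat using (ℕ; _*_; _∸_)
open import Data.Bool using (Bool; true; false; not)
open import Data.Fin using (Fin; zero; suc; _<_)
open import Data.Fin.Subset using (Subset; ⁅_⁆; _∪_; _∩_; _∈_; _⊆_; ∣_∣)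
import Data.Fin.Subset as S
open import Data.Vec using (Vec; []; _∷_; foldr)
open import Data.Vec.Relation.Unary.All using (All)
open import Data.Product using (Σ; ∃; _×_; _,_)
open import Data.Sum using (_⊎_)
open import Relation.Binary.PropositionalEquality using (_≡_)
open import Relation.Nullary using (¬_)

-- A k-uniform hypergraph on vertex set Fin n (vertex i+1 of the paper is index i : Fin n).
record Hypergraph (n k : ℕ) : Set where
  field
    edge    : Subset n → Bool
    uniform : ∀ (e : Subset n) → edge e ≡ true → ∣ e ∣ ≡ k
open Hypergraph public

-- 2-colorings: false = color 0, true = color 1
Coloring : ℕ → Set
Coloring n = Fin n → Bool

module _ {n k : ℕ} (H : Hypergraph n k) where

  Proper : Coloring n → Set
  Proper c = ∀ (e : Subset n) → edge H e ≡ true →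
             ¬ (Σ Bool λ b → ∀ x → x ∈ e → c x ≡ b)

  TwoColorable : Set
  TwoColorable = ∃ λ c → Proper c

  LexLeq : Coloring n → Coloring n → Set
  LexLeq c c' = (∀ i → c i ≡ c' i)
              ⊎ (Σ (Fin n) λ i → (∀ j → j < i → c j ≡ c' j) × c i ≡ false × c' i ≡ true)

  LexFirstProper : Coloring n → Set
  LexFirstProper c = Proper c × (∀ c' → Proper c' → LexLeq c c')

  setOf : ∀ {m} → Vec (Fin n) m → Subset n
  setOf = foldr _ (λ x s → ⁅ x ⁆ ∪ s) S.⊥

  NbrNonempty : Fin n → Subset n → Set
  NbrNonempty v X = Σ (Subset n) λ T → T ⊆ X × ∣ T ∣ ≡ k ∸ 1 × edge H (⁅ v ⁆ ∪ T) ≡ true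

  IsKll : ℕ → Subset n → Subset n → Set
  IsKll ℓ A B = ∣ A ∣ ≡ ℓ × ∣ B ∣ ≡ ℓ × (∀ x → x ∈ A → x ∈ B → ⊥')
              × (∀ (e : Subset n) → ∣ e ∣ ≡ k → e ⊆ (A ∪ B) →
                   (∣ e ∩ A ∣ ≡ 1 ⊎ ∣ e ∩ B ∣ ≡ 1) → edge H e ≡ true)
    where open import Data.Empty renaming (⊥ to ⊥')

  Spans : (ℓ : ℕ) → Vec (Fin n) (2 * ℓ) → Subset n → Subset n → Set
  Spans ℓ xs A B = setOf xs ≡ (A ∪ B) × IsKll ℓ A B

  ℓ₀ : ℕ
  ℓ₀ = 5 * k

  AllNbr : ∀ {m} → Vec (Fin n) m → Subset n → Set
  AllNbr vs X = All (λ v → NbrNonempty v X) vs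

  -- Step (a) can terminate successfully with independent sets A, B and colour cA
  -- for A (colour of B is not cA). `one` is vertex 1.
  StepA : Fin n → Subset n → Subset n → Bool → Set
  StepA one A B cA =
    Σ (Vec (Fin n) (2 * ℓ₀)) λ xs → Σ (Vec (Fin n) (k ∸ 1)) λ ys →
      Spans ℓ₀ xs A B × edge H (setOf (one ∷ ys)) ≡ true ×
      ((AllNbr ys A × cA ≡ false) ⊎ (AllNbr ys B × cA ≡ true))

  StepBReturns : Fin n → Subset n → Subset n → Bool → Bool → Set
  StepBReturns u A B cA b =
    Σ (Vec (Fin n) (k ∸ 1)) λ vs → edge H (setOf (u ∷ vs)) ≡ true ×
      ((AllNbr vs A × b ≡ cA) ⊎ (¬ AllNbr vs A × AllNbr vs B × b ≡ not cA))

  StepBFails : Fin n → Subset n → Subset n → Set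
  StepBFails u A B =
    ¬ (Σ (Vec (Fin n) (k ∸ 1)) λ vs → edge H (setOf (u ∷ vs)) ≡ true ×
         (AllNbr vs A ⊎ AllNbr vs B))

  StepC : Fin n → Bool → Set
  StepC u b = Σ (Coloring n) λ c → LexFirstProper c × c u ≡ b

  -- vertex 1 (exists whenever some vertex u exists)
  vertex1 : Fin n → Fin n
  vertex1 zero    = zero
  vertex1 (suc _) = zero

  -- b is a possible answer of one call of Coloring-Oracle on query u
  -- (over all outcomes of its internal randomness)
  OracleOutput : Fin n → Bool → Set
  OracleOutput u b =
      (Σ (Subset n) λ A → Σ (Subset n) λ B → Σ Bool λ cA →
         StepA (vertex1 u) A B cA × StepBReturns u A B cA b)
    ⊎ (Σ (Subset n) λ A → Σ (Subset n) λ B → Σ Bool λ cA →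
         StepA (vertex1 u) A B cA × StepBFails u A B × StepC u b)
    ⊎ (¬ (Σ (Subset n) λ A → Σ (Subset n) λ B → Σ Bool λ cA → StepA (vertex1 u) A B cA)
         × StepC u b)

{-# OPTIONS --safe #-}
module Submission where

-- In a proper 2-coloring, each side of a copy of K_{ℓ,ℓ} with ℓ ≥ 2(k-1) is monochromatic and
-- the two sides get opposite colors: by pigeonhole one side contains k-1 vertices of a common
-- color d, each vertex of the other side spans an edge with them and so has color ¬d, and the
-- same argument run from the other side finishes. A vertex v with N(v,X) ≠ ∅ for a monochromatic
-- side X gets the opposite color of X, so once vertex 1 has color 0 the edge through vertex 1 of
-- step (a) forces c_A to be the color of A, and the edge through u of step (b) forces the answer
-- to be the color of u. Hence step-(b) answers agree with every proper coloring giving vertex 1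
-- color 0. If some answer comes from step (c), the lexicographically first proper coloring works:
-- it is unique and gives vertex 1 color 0, as flipping all colors preserves properness.
-- Otherwise flip a given proper coloring if necessary.

open import Defs
open import Data.Nat using (ℕ; suc; zero; _+_; _*_; _∸_; _≤_; s≤s; z≤n)
open import Data.Nat.Properties
  using (≤-pred; +-suc; ≤-trans; +-mono-≤; +-monoʳ-≤; m∸n≤m; m≤m+n; m+[n∸m]≡n)
open import Data.Fin using (Fin; zero; suc)
open import Data.Fin.Properties using (<-cmp)
open import Data.Fin.Subset using (Subset; ⁅_⁆; _∪_; _∩_; _∈_; _∉_; _⊆_; ∣_∣; inside; outside)
import Data.Fin.Subset as Subset
open import Data.Fin.Subset.Properties
  using ( ∉⊥; ∣⊥∣≡0; x∈⁅x⁆; x∈⁅y⁆⇒x≡y; ∣⁅x⁆∣≡1; ⊆-antisym; x∈p∩q⁺; x∈p∩q⁻; x∈p∪q⁻; x∈p∪q⁺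
        ; ∪-identityˡ; ∪-comm)
open import Data.Bool using (Bool; true; false; not)
open import Data.Bool.Properties using (not-involutive; not-injective; not-¬; ¬-not)
open import Data.Vec using (Vec; []; _∷_; here; there)
open import Data.Vec.Relation.Unary.All as All using (All; []; _∷_)
open import Data.List using (List)
open import Data.List.Relation.Binary.Pointwise as Pointwise using (Pointwise; []; _∷_)
open import Data.Product using (Σ; ∃; _×_; _,_; proj₁; proj₂)
open import Data.Sum as Sum using (_⊎_; inj₁; inj₂)
open import Data.Empty using (⊥-elim)
open import Relation.Binary.PropositionalEquality using (_≡_; refl; sym; trans; cong; subst)
open import Relation.Binary using (tri<; tri≈; tri>)
open import Relation.Nullary using (contradiction)
open import Function using (_∘_)

∣⁅x⁆∪p∣≡1+∣p∣ : ∀ {n} (x : Fin n) (p : Subset n) → x ∉ p → ∣ ⁅ x ⁆ ∪ p ∣ ≡ suc ∣ p ∣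
∣⁅x⁆∪p∣≡1+∣p∣ zero    (inside  ∷ p) x∉p = ⊥-elim (x∉p here)
∣⁅x⁆∪p∣≡1+∣p∣ zero    (outside ∷ p) x∉p = cong (suc ∘ ∣_∣) (∪-identityˡ p)
∣⁅x⁆∪p∣≡1+∣p∣ (suc x) (inside  ∷ p) x∉p = cong suc (∣⁅x⁆∪p∣≡1+∣p∣ x p (x∉p ∘ there))
∣⁅x⁆∪p∣≡1+∣p∣ (suc x) (outside ∷ p) x∉p = ∣⁅x⁆∪p∣≡1+∣p∣ x p (x∉p ∘ there)

module _ {n : ℕ} where

  ∣[⁅x⁆∪p]∩q∣≡1 : ∀ {x : Fin n} {p q : Subset n} → x ∈ q → (∀ y → y ∈ p → y ∉ q) →
                  ∣ (⁅ x ⁆ ∪ p) ∩ q ∣ ≡ 1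
  ∣[⁅x⁆∪p]∩q∣≡1 {x} {p} {q} x∈q p∩q≡∅ = trans (cong ∣_∣ [⁅x⁆∪p]∩q≡⁅x⁆) (∣⁅x⁆∣≡1 x)
    where
    [⁅x⁆∪p]∩q≡⁅x⁆ : (⁅ x ⁆ ∪ p) ∩ q ≡ ⁅ x ⁆
    [⁅x⁆∪p]∩q≡⁅x⁆ = ⊆-antisym ⊆⁅x⁆ ⁅x⁆⊆
      where
      ⊆⁅x⁆ : (⁅ x ⁆ ∪ p) ∩ q ⊆ ⁅ x ⁆
      ⊆⁅x⁆ {y} y∈ with x∈p∩q⁻ _ q y∈
      ... | y∈⁅x⁆∪p , y∈q with x∈p∪q⁻ ⁅ x ⁆ p y∈⁅x⁆∪p
      ...   | inj₁ y∈⁅x⁆ = y∈⁅x⁆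
      ...   | inj₂ y∈p   = ⊥-elim (p∩q≡∅ y y∈p y∈q)
      ⁅x⁆⊆ : ⁅ x ⁆ ⊆ (⁅ x ⁆ ∪ p) ∩ q
      ⁅x⁆⊆ y∈⁅x⁆ rewrite x∈⁅y⁆⇒x≡y x y∈⁅x⁆ = x∈p∩q⁺ (x∈p∪q⁺ (inj₁ (x∈⁅x⁆ x)) , x∈q)

  ⁅x⁆∪p⊆q∪r : ∀ {x : Fin n} {p q r : Subset n} → x ∈ q → p ⊆ r → ⁅ x ⁆ ∪ p ⊆ q ∪ r
  ⁅x⁆∪p⊆q∪r {x} {p} x∈q p⊆r y∈ with x∈p∪q⁻ ⁅ x ⁆ p y∈
  ... | inj₁ y∈⁅x⁆ rewrite x∈⁅y⁆⇒x≡y x y∈⁅x⁆ = x∈p∪q⁺ (inj₁ x∈q)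
  ... | inj₂ y∈p = x∈p∪q⁺ (inj₂ (p⊆r y∈p))

  Monochromatic : Coloring n → Bool → Subset n → Set
  Monochromatic c d X = ∀ x → x ∈ X → c x ≡ d

  MonochromaticSubset : Coloring n → Subset n → ℕ → Bool → Set
  MonochromaticSubset c X p d = Σ (Subset n) λ T → T ⊆ X × ∣ T ∣ ≡ p × Monochromatic c d T

  Monochromatic-⁅x⁆∪ : ∀ {c d x T} → c x ≡ d → Monochromatic c d T → Monochromatic c d (⁅ x ⁆ ∪ T)
  Monochromatic-⁅x⁆∪ {x = x} {T} cx≡d mono y y∈ with x∈p∪q⁻ ⁅ x ⁆ T y∈
  ... | inj₁ y∈⁅x⁆ rewrite x∈⁅y⁆⇒x≡y x y∈⁅x⁆ = cx≡d
  ... | inj₂ y∈T = mono y y∈T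

module _ {n : ℕ} {c : Coloring (suc n)} where

  lift-skip : ∀ {s X p d} → MonochromaticSubset (c ∘ suc) X p d → MonochromaticSubset c (s ∷ X) p d
  lift-skip (T , T⊆X , ∣T∣ , mono) =
    outside ∷ T , (λ { (there y∈T) → there (T⊆X y∈T) }) , ∣T∣ ,
    λ { (suc y) (there y∈T) → mono y y∈T }

  lift-take : ∀ {X p d} → c zero ≡ d → MonochromaticSubset (c ∘ suc) X p d →
              MonochromaticSubset c (inside ∷ X) (suc p) d
  lift-take c0≡d (T , T⊆X , ∣T∣ , mono) =
    inside ∷ T , (λ { here → here ; (there y∈T) → there (T⊆X y∈T) }) , cong suc ∣T∣ ,
    λ { zero here → c0≡d ; (suc y) (there y∈T) → mono y y∈T }

∅-monochromatic : ∀ {n} (c : Coloring n) (X : Subset n) d → MonochromaticSubset c X 0 d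
∅-monochromatic {n} _ _ _ = Subset.⊥ , ⊥-elim ∘ ∉⊥ , ∣⊥∣≡0 n , λ _ → ⊥-elim ∘ ∉⊥

pigeonhole : ∀ {n} (c : Coloring n) (X : Subset n) (p q : ℕ) → p + q ≤ ∣ X ∣ →
             MonochromaticSubset c X p false ⊎ MonochromaticSubset c X q true
pigeonhole c X zero q _ = inj₁ (∅-monochromatic c X false)
pigeonhole c X (suc p) zero _ = inj₂ (∅-monochromatic c X true)
pigeonhole c [] (suc p) (suc q) ()
pigeonhole c (outside ∷ X) (suc p) (suc q) p+q≤∣X∣ =
  Sum.map lift-skip lift-skip (pigeonhole (c ∘ suc) X (suc p) (suc q) p+q≤∣X∣)
pigeonhole c (inside ∷ X) (suc p) (suc q) p+q≤∣X∣ with c zero in c0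
... | false = Sum.map (lift-take c0) lift-skip (pigeonhole (c ∘ suc) X p (suc q) (≤-pred p+q≤∣X∣))
... | true  = Sum.map lift-skip (lift-take c0)
  (pigeonhole (c ∘ suc) X (suc p) q (subst (_≤ ∣ X ∣) (+-suc p q) (≤-pred p+q≤∣X∣)))

monochromaticSubset : ∀ {n} (c : Coloring n) (X : Subset n) (p : ℕ) → p + p ≤ ∣ X ∣ →
                      ∃ (MonochromaticSubset c X p)
monochromaticSubset c X p p+p≤∣X∣ = Sum.[ (false ,_) , (true ,_) ] (pigeonhole c X p p p+p≤∣X∣)

k∸1+k∸1≤5k : ∀ k → k ∸ 1 + (k ∸ 1) ≤ 5 * k
k∸1+k∸1≤5k k = ≤-trans (+-mono-≤ (m∸n≤m k 1) (m∸n≤m k 1)) (+-monoʳ-≤ k (m≤m+n k (3 * k)))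

module _ {n k : ℕ} (H : Hypergraph n k) where

  IsKll-sym : ∀ {ℓ A B} → IsKll H ℓ A B → IsKll H ℓ B A
  IsKll-sym {A = A} {B} (∣A∣ , ∣B∣ , disjoint , complete) =
    ∣B∣ , ∣A∣ , (λ x x∈B x∈A → disjoint x x∈A x∈B) ,
    λ e ∣e∣ e⊆B∪A one-vertex →
      complete e ∣e∣ (subst (e ⊆_) (∪-comm B A) e⊆B∪A) (Sum.swap one-vertex)

  IsKll-edge : ∀ {ℓ A B x T} → 1 ≤ k → IsKll H ℓ A B → x ∈ A → T ⊆ B → ∣ T ∣ ≡ k ∸ 1 →
               edge H (⁅ x ⁆ ∪ T) ≡ true
  IsKll-edge {x = x} {T} 1≤k (_ , _ , disjoint , complete) x∈A T⊆B ∣T∣ =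
    complete (⁅ x ⁆ ∪ T) ∣⁅x⁆∪T∣ (⁅x⁆∪p⊆q∪r x∈A T⊆B)
      (inj₁ (∣[⁅x⁆∪p]∩q∣≡1 x∈A λ y y∈T y∈A → disjoint y y∈A (T⊆B y∈T)))
    where
    ∣⁅x⁆∪T∣ : ∣ ⁅ x ⁆ ∪ T ∣ ≡ k
    ∣⁅x⁆∪T∣ = trans (∣⁅x⁆∪p∣≡1+∣p∣ x T (disjoint x x∈A ∘ T⊆B))
                    (trans (cong suc ∣T∣) (m+[n∸m]≡n 1≤k))

  Monochromatic-setOf : ∀ {c m d} {vs : Vec (Fin n) m} → All (λ v → c v ≡ d) vs →
                        Monochromatic c d (setOf H vs)
  Monochromatic-setOf []         _ x∈∅ = ⊥-elim (∉⊥ x∈∅)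
  Monochromatic-setOf (cv ∷ cvs)     = Monochromatic-⁅x⁆∪ cv (Monochromatic-setOf cvs)

  AnsweredInStepB : Fin n → Bool → Set
  AnsweredInStepB u b = Σ (Subset n) λ A → Σ (Subset n) λ B → Σ Bool λ cA →
    StepA H (vertex1 H u) A B cA × StepBReturns H u A B cA b

  module _ {c : Coloring n} (proper : Proper H c) where

    apex-color : ∀ {v T d} → edge H (⁅ v ⁆ ∪ T) ≡ true → Monochromatic c d T → c v ≡ not d
    apex-color {d = d} e mono = ¬-not λ cv≡d → proper _ e (d , Monochromatic-⁅x⁆∪ cv≡d mono)

    IsKll-opposite-side : ∀ {ℓ A B d} → 1 ≤ k → IsKll H ℓ A B →
                          MonochromaticSubset c B (k ∸ 1) d → Monochromatic c (not d) A
    IsKll-opposite-side 1≤k K (T , T⊆B , ∣T∣ , mono) x x∈A =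
      apex-color (IsKll-edge 1≤k K x∈A T⊆B ∣T∣) mono

    IsKll-coloring : ∀ {ℓ A B} → 1 ≤ k → k ∸ 1 + (k ∸ 1) ≤ ℓ → IsKll H ℓ A B →
                     Σ Bool λ a → Monochromatic c a A × Monochromatic c (not a) B
    IsKll-coloring {ℓ} {A} {B} 1≤k bound K@(∣A∣ , ∣B∣ , _) = not d , monoA , monoB
      where
      fits : ∀ X → ∣ X ∣ ≡ ℓ → k ∸ 1 + (k ∸ 1) ≤ ∣ X ∣
      fits X ∣X∣ = subst (k ∸ 1 + (k ∸ 1) ≤_) (sym ∣X∣) bound
      B-subset : ∃ (MonochromaticSubset c B (k ∸ 1))
      B-subset = monochromaticSubset c B (k ∸ 1) (fits B ∣B∣)
      d : Bool
      d = proj₁ B-subset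
      monoA : Monochromatic c (not d) A
      monoA = IsKll-opposite-side 1≤k K (proj₂ B-subset)
      monoB : Monochromatic c (not (not d)) B
      monoB =
        let _ , T , T⊆A , ∣T∣ , _ = monochromaticSubset c A (k ∸ 1) (fits A ∣A∣)
        in IsKll-opposite-side 1≤k (IsKll-sym K) (T , T⊆A , ∣T∣ , λ x x∈T → monoA x (T⊆A x∈T))

    neighbor-color : ∀ {v X d} → NbrNonempty H v X → Monochromatic c d X → c v ≡ not d
    neighbor-color (T , T⊆X , _ , e) mono = apex-color e λ x x∈T → mono x (T⊆X x∈T)

    neighbors-apex-color : ∀ {m u} {vs : Vec (Fin n) m} {X d} → edge H (setOf H (u ∷ vs)) ≡ true →
                           AllNbr H vs X → Monochromatic c d X → c u ≡ d
    neighbors-apex-color {d = d} e nbrs mono = trans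
      (apex-color e (Monochromatic-setOf (All.map (λ nbr → neighbor-color nbr mono) nbrs)))
      (not-involutive d)

    StepA-choice-color : ∀ {m one a cA A B} {ys : Vec (Fin n) m} → c one ≡ false →
                         edge H (setOf H (one ∷ ys)) ≡ true →
                         Monochromatic c a A → Monochromatic c (not a) B →
                         (AllNbr H ys A × cA ≡ false) ⊎ (AllNbr H ys B × cA ≡ true) → a ≡ cA
    StepA-choice-color c1 e monoA monoB (inj₁ (nbrs , cA≡false)) =
      trans (sym (neighbors-apex-color e nbrs monoA)) (trans c1 (sym cA≡false))
    StepA-choice-color c1 e monoA monoB (inj₂ (nbrs , cA≡true)) =
      trans (not-injective (trans (sym (neighbors-apex-color e nbrs monoB)) c1)) (sym cA≡true)

    StepA-colors : ∀ {one A B cA} → 1 ≤ k → c one ≡ false → StepA H one A B cA →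
                   Monochromatic c cA A × Monochromatic c (not cA) B
    StepA-colors {A = A} {B} 1≤k c1 (_ , _ , (_ , K) , e , choice) =
      let a , monoA , monoB = IsKll-coloring 1≤k (k∸1+k∸1≤5k k) K
      in subst (λ a → Monochromatic c a A × Monochromatic c (not a) B)
               (StepA-choice-color c1 e monoA monoB choice) (monoA , monoB)

    StepBReturns-color : ∀ {u A B cA b} → Monochromatic c cA A → Monochromatic c (not cA) B →
                         StepBReturns H u A B cA b → c u ≡ b
    StepBReturns-color monoA monoB (_ , e , inj₁ (nbrs , b≡cA)) =
      trans (neighbors-apex-color e nbrs monoA) (sym b≡cA)
    StepBReturns-color monoA monoB (_ , e , inj₂ (_ , nbrs , b≡not-cA)) =
      trans (neighbors-apex-color e nbrs monoB) (sym b≡not-cA)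

    AnsweredInStepB-color : ∀ {u b} → 1 ≤ k → c (vertex1 H u) ≡ false →
                            AnsweredInStepB u b → c u ≡ b
    AnsweredInStepB-color 1≤k c1 (_ , _ , _ , stepA , stepB) =
      let monoA , monoB = StepA-colors 1≤k c1 stepA in StepBReturns-color monoA monoB stepB

  LexLeq-antisym : ∀ {c c'} → LexLeq H c c' → LexLeq H c' c → ∀ i → c i ≡ c' i
  LexLeq-antisym (inj₁ c≗c') _ = c≗c'
  LexLeq-antisym (inj₂ (i , _ , ci , c'i)) (inj₁ c'≗c) =
    contradiction (trans (sym c'i) (trans (c'≗c i) ci)) λ ()
  LexLeq-antisym (inj₂ (i , below-i , ci , c'i)) (inj₂ (j , below-j , c'j , cj)) with <-cmp i j
  ... | tri< i<j _ _  = contradiction (trans (sym c'i) (trans (below-j i i<j) ci)) λ ()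
  ... | tri≈ _ refl _ = contradiction (trans (sym cj) ci) λ ()
  ... | tri> _ _ j<i  = contradiction (trans (sym cj) (trans (below-i j j<i) c'j)) λ ()

  LexFirstProper-unique : ∀ {c c'} → LexFirstProper H c → LexFirstProper H c' → ∀ i → c i ≡ c' i
  LexFirstProper-unique {c} {c'} (proper , least) (proper' , least') =
    LexLeq-antisym (least c' proper') (least' c proper)

  Proper-not : ∀ {c} → Proper H c → Proper H (not ∘ c)
  Proper-not {c} proper e e∈H (b , mono) =
    proper e e∈H (not b , λ x x∈e → trans (sym (not-involutive (c x))) (cong not (mono x x∈e)))

LexFirstProper-zero : ∀ {n k} (H : Hypergraph (suc n) k) {c} → LexFirstProper H c → c zero ≡ false
LexFirstProper-zero H {c} (proper , least) with c zero in c0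
... | false = refl
... | true  = contradiction (LexLeq-antisym H (least (not ∘ c) (Proper-not H proper)) flipped≤c zero)
                            (not-¬ refl)
  where
  flipped≤c : LexLeq H (not ∘ c) c
  flipped≤c = inj₂ (zero , (λ _ ()) , cong not c0 , c0)

LexFirstProper-vertex1 : ∀ {n k} (H : Hypergraph n k) {c} → LexFirstProper H c →
                         ∀ u → c (vertex1 H u) ≡ false
LexFirstProper-vertex1 H lexFirst zero    = LexFirstProper-zero H lexFirst
LexFirstProper-vertex1 H lexFirst (suc _) = LexFirstProper-zero H lexFirst

normalizedColoring : ∀ {n k} (H : Hypergraph n k) → TwoColorable H →
                     Σ (Coloring n) λ c → Proper H c × (∀ u → c (vertex1 H u) ≡ false)
normalizedColoring {zero}  H (c , proper) = c , proper , λ ()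
normalizedColoring {suc n} H (c , proper) with c zero in c0
... | false = c , proper , λ { zero → c0 ; (suc _) → c0 }
... | true  = not ∘ c , Proper-not H proper , λ { zero → cong not c0 ; (suc _) → cong not c0 }

module _ {n k : ℕ} (H : Hypergraph n k) where

  lexFirst-or-stepB : ∀ {qs bs} → Pointwise (OracleOutput H) qs bs →
                      Σ (Coloring n) (LexFirstProper H) ⊎ Pointwise (AnsweredInStepB H) qs bs
  lexFirst-or-stepB [] = inj₂ []
  lexFirst-or-stepB (inj₁ stepB ∷ outputs) = Sum.map₂ (stepB ∷_) (lexFirst-or-stepB outputs)
  lexFirst-or-stepB (inj₂ (inj₁ (_ , _ , _ , _ , _ , c , lexFirst , _)) ∷ _) = inj₁ (c , lexFirst)
  lexFirst-or-stepB (inj₂ (inj₂ (_ , c , lexFirst , _)) ∷ _) = inj₁ (c , lexFirst)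

  OracleOutput-lexFirst : ∀ {c u b} → 1 ≤ k → LexFirstProper H c → OracleOutput H u b → c u ≡ b
  OracleOutput-lexFirst {u = u} 1≤k lexFirst (inj₁ stepB) =
    AnsweredInStepB-color H (proj₁ lexFirst) 1≤k (LexFirstProper-vertex1 H lexFirst u) stepB
  OracleOutput-lexFirst {u = u} _ lexFirst (inj₂ (inj₁ (_ , _ , _ , _ , _ , _ , lexFirst' , c'u))) =
    trans (LexFirstProper-unique H lexFirst lexFirst' u) c'u
  OracleOutput-lexFirst {u = u} _ lexFirst (inj₂ (inj₂ (_ , _ , lexFirst' , c'u))) =
    trans (LexFirstProper-unique H lexFirst lexFirst' u) c'u

  OracleOutputs-consistent : ∀ {qs bs} → 1 ≤ k → TwoColorable H → Pointwise (OracleOutput H) qs bs →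
                             Σ (Coloring n) λ c → Proper H c × Pointwise (λ u b → c u ≡ b) qs bs
  OracleOutputs-consistent 1≤k colorable outputs with lexFirst-or-stepB outputs
  ... | inj₁ (c , lexFirst) =
    c , proj₁ lexFirst , Pointwise.map (OracleOutput-lexFirst 1≤k lexFirst) outputs
  ... | inj₂ stepB-answers =
    let c , proper , c1 = normalizedColoring H colorable
    in c , proper , Pointwise.map (λ {u} → AnsweredInStepB-color H proper 1≤k (c1 u)) stepB-answers

lemma4p1 : ∀ (k n : ℕ) → 3 ≤ k → (H : Hypergraph n k) → TwoColorable H →
           (qs : List (Fin n)) (answers : List Bool) →
           Pointwise (OracleOutput H) qs answers →
           Σ (Coloring n) λ c → Proper H c × Pointwise (λ u b → c u ≡ b) qs answers
lemma4p1 k n 3≤k H colorable _ _ = OracleOutputs-consistent H (≤-trans (s≤s z≤n) 3≤k) colorable
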